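{- Let $p=\{p_n\}_{n=0}^\infty$ be a sequence of real numbers. The following are equivalent: (i) $p\in TN_2$; (ii) $p$ is non-negative and $p_ap_d\le p_bp_c$ for all integers $a,b,c,d$ with $a\ge b\ge c\ge d\ge0$ and $a+d=b+c$; (iii) $p$ is non-negative and for every positive integer $m$ and all $\lambda,\mu\in\mathcal{P}^m$ with $\lambda\trianglerighteq\mu$, we have $p_\lambda\le p_\mu$.
   Context: $\mathcal{T}_p$ is the $\mathbb{N}\times\mathbb{N}$ matrix ($\mathbb{N}$ the non-negative integers) with $(\mathcal{T}_p)_{i,j}=p_{j-i}$, where $p_n=0$ for $n<0$; $p\in TN_2$ means every minor of $\mathcal{T}_p$ of order at most $2$ is non-negative. $p$ is non-negative if $p_n\ge0$ for all $n$. $\mathcal{P}^m$ is the set of non-increasing functions $\lambda:\{1,\ldots,m\}\to\mathbb{N}$ (partitions with $m$ non-negative parts); $|\lambda|=\sum_{i=1}^m\lambda(i)$; for $\lambda,\mu\in\mathcal{P}^m$, $\lambda\trianglerighteq\mu$ means $|\lambda|=|\mu|$ and $\sum_{i=1}^j\lambda(i)\ge\sum_{i=1}^j\mu(i)$ for all $1\le j\le m$. For $\lambda\in\mathcal{P}^m$, $p_\lambda=\prod_{i=1}^m p_{\lambda(i)}$. -}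

module Defs where

open import Level using (Level; _⊔_; suc)
open import Data.Nat as ℕ using (ℕ; zero; suc; _∸_)
open import Data.Nat.Properties using (_≤?_)
open import Data.Fin as Fin using (Fin)
open import Data.Product using (_×_)
open import Relation.Nullary using (yes; no)
open import Relation.Binary.PropositionalEquality using (_≡_)
open import Relation.Binary.Structures using (IsTotalOrder)
open import Algebra.Bundles using (CommutativeRing)

-- Ordered commutative rings (the standard library has none).
-- ℝ is an instance; the statement is proved for every such ring.

record OrderedCommutativeRing (c ℓ₁ ℓ₂ : Level) : Set (Level.suc (c ⊔ ℓ₁ ⊔ ℓ₂)) where
  field
    commutativeRing : CommutativeRing c ℓ₁
  open CommutativeRing commutativeRing public
  infix 4 _≤_
  field
    _≤_          : Carrier → Carrier → Set ℓ₂
    isTotalOrder : IsTotalOrder _≈_ _≤_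
    +-monoˡ-≤    : ∀ {x y} z → x ≤ y → x + z ≤ y + z
    *-nonneg     : ∀ {x y} → 0# ≤ x → 0# ≤ y → 0# ≤ x * y

module _ {c ℓ₁ ℓ₂} (R : OrderedCommutativeRing c ℓ₁ ℓ₂) where
  open OrderedCommutativeRing R

  toeplitz : (ℕ → Carrier) → ℕ → ℕ → Carrier
  toeplitz p i j with i ≤? j
  ... | yes _ = p (j ∸ i)
  ... | no  _ = 0#

  TN₂ : (ℕ → Carrier) → Set ℓ₂
  TN₂ p =
    (∀ i j → 0# ≤ toeplitz p i j) ×
    (∀ i k j l → i ℕ.< k → j ℕ.< l →
       0# ≤ toeplitz p i j * toeplitz p k l - toeplitz p i l * toeplitz p k j)

  NonNegative : (ℕ → Carrier) → Set ℓ₂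
  NonNegative p = ∀ n → 0# ≤ p n

  prodP : (ℕ → Carrier) → ∀ {m} → (Fin m → ℕ) → Carrier
  prodP p {zero}  λ′ = 1#
  prodP p {suc m} λ′ = p (λ′ Fin.zero) * prodP p (λ i → λ′ (Fin.suc i))

-- Partitions with m non-negative parts, indexed by Fin m (part i+1 of
-- the paper is value at index i).

IsPartition : ∀ {m} → (Fin m → ℕ) → Set
IsPartition {m} λ′ = ∀ (i j : Fin m) → i Fin.≤ j → λ′ j ℕ.≤ λ′ i

prefixSum : ∀ {m} → (Fin m → ℕ) → ℕ → ℕ
prefixSum {zero}  f j       = 0
prefixSum {suc m} f zero    = 0
prefixSum {suc m} f (suc j) = f Fin.zero ℕ.+ prefixSum (λ i → f (Fin.suc i)) j

size : ∀ {m} → (Fin m → ℕ) → ℕ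
size {m} f = prefixSum f m

_⊵_ : ∀ {m} → (Fin m → ℕ) → (Fin m → ℕ) → Set
_⊵_ {m} λ′ μ = size λ′ ≡ size μ ×
  (∀ j → 1 ℕ.≤ j → j ℕ.≤ m → prefixSum μ j ℕ.≤ prefixSum λ′ j)

module Submission where

-- The hub of the proof is the exchange inequality
--   p(t+s+u) · p(t) ≤ p(t+s) · p(t+u)        for all t, s, u,
-- which is (ii) with its four indices parametrised by their differences.
-- Every 2×2 minor of T_p with rows i < i+s and columns i+s+t < i+s+t+u is
-- exactly  p(t+s)p(t+u) − p(t+s+u)p(t)  (minor-exchange), and every other
-- minor is a product of entries or zero; hence (i) ⇔ nonnegativity plus the
-- exchange inequality, and the latter is a reindexing of (ii).
--
-- For (ii) ⇒ (iii) we read λ ⊵ μ as "λ covers μ": scanning the parts from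
-- the left, the running surplus of λ over μ never becomes negative and
-- vanishes at the end (Covers).  The surplus d = λ₁ − μ₁ of the first part
-- is moved, one unit at a time, into later parts of λ that are still below
-- μ (transfer, drain); each unit move is one exchange inequality and does
-- not decrease the product.
-- Conversely (iii) ⇒ (ii) is (iii) for the two-part partitions (a, d) ⊵ (b, c).

open import Defs
import Data.Nat
open import Data.Nat as ℕ using (ℕ; zero; suc; z≤n; s≤s)
import Data.Nat.Properties as ℕₚ
open import Data.Nat.Tactic.RingSolver using (solve-∀)
open import Data.Fin using (Fin)
open import Data.Vec.Functional using (head; tail; _∷_; [])
open import Data.Product using (_×_; _,_; ∃-syntax; proj₁; proj₂)
open import Data.Sum using (inj₁; inj₂)
open import Data.Empty using (⊥-elim)
open import Relation.Nullary using (yes; no)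
open import Relation.Binary.PropositionalEquality as ≡ using (_≡_; refl)
open import Relation.Binary.Structures using (IsTotalOrder)
open import Function.Bundles using (_⇔_; mk⇔)
import Algebra.Properties.Ring as RingProperties
import Algebra.Properties.CommutativeSemigroup as CommSemigroupProperties

module OrderedRingFacts {c ℓ₁ ℓ₂} (R : OrderedCommutativeRing c ℓ₁ ℓ₂) where
  open OrderedCommutativeRing R
  open RingProperties ring using (-‿distribʳ-*; -1*x≈-x; -0#≈0#; -‿involutive)
  open IsTotalOrder isTotalOrder using (total)
  open IsTotalOrder isTotalOrder public using (≤-respˡ-≈; ≤-respʳ-≈)
    renaming (refl to ≤-refl; trans to ≤-trans; reflexive to ≤-reflexive)

  ≤⇒0≤- : ∀ {x y} → x ≤ y → 0# ≤ y - x
  ≤⇒0≤- {x} h = ≤-respˡ-≈ (-‿inverseʳ x) (+-monoˡ-≤ (- x) h)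

  0≤-⇒≤ : ∀ {x y} → 0# ≤ y - x → x ≤ y
  0≤-⇒≤ {x} {y} h = ≤-respʳ-≈ cancel (≤-respˡ-≈ (+-identityˡ x) (+-monoˡ-≤ x h))
    where
    cancel : (y - x) + x ≈ y
    cancel = trans (+-assoc y (- x) x) (trans (+-congˡ (-‿inverseˡ x)) (+-identityʳ y))

  *-monoˡ-≤-nonneg : ∀ {x y} z → 0# ≤ z → x ≤ y → z * x ≤ z * y
  *-monoˡ-≤-nonneg {x} {y} z 0≤z x≤y = 0≤-⇒≤ (≤-respʳ-≈ expand (*-nonneg 0≤z (≤⇒0≤- x≤y)))
    where
    expand : z * (y - x) ≈ z * y - z * x
    expand = trans (distribˡ z y (- x)) (+-congˡ (sym (-‿distribʳ-* z x)))

  -- 1 is nonnegative: otherwise 0 ≤ −1, and then 0 ≤ (−1)(−1) = 1.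
  0≤1 : 0# ≤ 1#
  0≤1 with total 0# 1#
  ... | inj₁ 0≤1 = 0≤1
  ... | inj₂ 1≤0 = ≤-respʳ-≈ square (*-nonneg 0≤-1 0≤-1)
    where
    0≤-1 : 0# ≤ - 1#
    0≤-1 = ≤-respʳ-≈ (+-identityˡ (- 1#)) (≤-respˡ-≈ (-‿inverseʳ 1#) (+-monoˡ-≤ (- 1#) 1≤0))
    square : - 1# * - 1# ≈ 1#
    square = trans (-1*x≈-x (- 1#)) (-‿involutive 1#)

  x-y*0≈x : ∀ x y → x - y * 0# ≈ x
  x-y*0≈x x y = trans (+-congˡ (trans (-‿cong (zeroʳ y)) -0#≈0#)) (+-identityʳ x)

module Covering where
  open Data.Nat using (_+_; _≤_)
  open ≡ using (sym; trans; cong; subst; subst₂)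
  open ℕₚ using (+-identityʳ; +-assoc; +-cancelˡ-≡; +-cancelˡ-≤; m+[n∸m]≡n; ≤-reflexive)

  -- Covers d f g : with an initial credit d, f covers g from the left, i.e.
  -- d + f₁ + … + fⱼ ≥ g₁ + … + gⱼ for every j, with equality for j = m.
  -- The witness d′ is the credit left over for the tails.
  Covers : ∀ {m} → ℕ → (Fin m → ℕ) → (Fin m → ℕ) → Set
  Covers {zero}  d f g = d ≡ 0
  Covers {suc m} d f g = ∃[ d′ ] d + head f ≡ head g + d′ × Covers d′ (tail f) (tail g)

  prefixSum-zero : ∀ {m} (f : Fin m → ℕ) → prefixSum f 0 ≡ 0
  prefixSum-zero {zero}  f = refl
  prefixSum-zero {suc m} f = refl

  prefixSum-one : ∀ {m} (f : Fin (suc m) → ℕ) → prefixSum f 1 ≡ head f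
  prefixSum-one f = trans (cong (head f +_) (prefixSum-zero (tail f))) (+-identityʳ (head f))

  prefix-bounds⇒Covers : ∀ {m} d (f g : Fin m → ℕ) → d + size f ≡ size g →
    (∀ j → j ≤ m → prefixSum g j ≤ d + prefixSum f j) → Covers d f g
  prefix-bounds⇒Covers {zero} d f g total bound = trans (sym (+-identityʳ d)) total
  prefix-bounds⇒Covers {suc m} d f g total bound =
    credit , sym split , prefix-bounds⇒Covers credit (tail f) (tail g) total′ bound′
    where
    head-bound : head g ≤ d + head f
    head-bound = subst₂ (λ x y → x ≤ d + y) (prefixSum-one g) (prefixSum-one f) (bound 1 (s≤s z≤n))
    credit : ℕ
    credit = d ℕ.+ head f ℕ.∸ head g
    split : head g + credit ≡ d + head f
    split = m+[n∸m]≡n head-bound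
    regroup : ∀ x → d + (head f + x) ≡ head g + (credit + x)
    regroup x = trans (sym (+-assoc d (head f) x))
                (trans (cong (_+ x) (sym split)) (+-assoc (head g) credit x))
    total′ : credit + size (tail f) ≡ size (tail g)
    total′ = +-cancelˡ-≡ (head g) _ _ (trans (sym (regroup (size (tail f)))) total)
    bound′ : ∀ j → j ≤ m → prefixSum (tail g) j ≤ credit + prefixSum (tail f) j
    bound′ j j≤m = +-cancelˡ-≤ (head g) _ _
      (subst (prefixSum g (suc j) ≤_) (regroup _) (bound (suc j) (s≤s j≤m)))

  ⊵⇒Covers : ∀ {m} (λ′ μ : Fin m → ℕ) → λ′ ⊵ μ → Covers 0 λ′ μ
  ⊵⇒Covers λ′ μ (total , dominates) = prefix-bounds⇒Covers 0 λ′ μ total bound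
    where
    bound : ∀ j → j ≤ _ → prefixSum μ j ≤ prefixSum λ′ j
    bound zero    _   = ≤-reflexive (trans (prefixSum-zero μ) (sym (prefixSum-zero λ′)))
    bound (suc j) j≤m = dominates (suc j) (s≤s z≤n) j≤m

open Covering

module Characterisation {c ℓ₁ ℓ₂} (R : OrderedCommutativeRing c ℓ₁ ℓ₂) where
  open OrderedCommutativeRing R hiding (_+_; +-monoˡ-≤; refl)
  open OrderedRingFacts R
  open CommSemigroupProperties *-commutativeSemigroup using (x∙yz≈y∙xz)
  open Data.Nat using (_+_)

  LogConcave : (ℕ → Carrier) → Set ℓ₂
  LogConcave p = ∀ a b c d → a ℕ.≥ b → b ℕ.≥ c → c ℕ.≥ d → a + d ≡ b + c →
    p a * p d ≤ p b * p c

  Exchange : (ℕ → Carrier) → Set ℓ₂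
  Exchange p = ∀ t s u → p (t + s + u) * p t ≤ p (t + s) * p (t + u)

  DominanceMonotone : (ℕ → Carrier) → Set ℓ₂
  DominanceMonotone p = ∀ (m : ℕ) → 0 ℕ.< m → (λ′ μ : Fin m → ℕ) →
    IsPartition λ′ → IsPartition μ → λ′ ⊵ μ → prodP R p λ′ ≤ prodP R p μ

  module _ (p : ℕ → Carrier) where

    LogConcave⇒Exchange : LogConcave p → Exchange p
    LogConcave⇒Exchange logConcave t s u with ℕₚ.≤-total s u
    ... | inj₁ s≤u = ≤-respʳ-≈ (*-comm _ _)
      (logConcave (t + s + u) (t + u) (t + s) t
        (ℕₚ.+-monoˡ-≤ u (ℕₚ.m≤m+n t s)) (ℕₚ.+-monoʳ-≤ t s≤u) (ℕₚ.m≤m+n t s) (balance t s u))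
      where
      balance : ∀ t s u → t + s + u + t ≡ t + u + (t + s)
      balance = solve-∀
    ... | inj₂ u≤s =
      logConcave (t + s + u) (t + s) (t + u) t
        (ℕₚ.m≤m+n (t + s) u) (ℕₚ.+-monoʳ-≤ t u≤s) (ℕₚ.m≤m+n t u) (balance t s u)
      where
      balance : ∀ t s u → t + s + u + t ≡ t + s + (t + u)
      balance = solve-∀

    -- Writing b = d + s and c = d + u, the balance a + d = b + c forces a = d + s + u.
    Exchange⇒LogConcave : Exchange p → LogConcave p
    Exchange⇒LogConcave exchange a b c d a≥b b≥c c≥d balance
      with ℕₚ.m≤n⇒∃[o]m+o≡n (ℕₚ.≤-trans c≥d b≥c) | ℕₚ.m≤n⇒∃[o]m+o≡n c≥d
    ... | s , refl | u , refl = ≡.subst (λ x → p x * p d ≤ p (d + s) * p (d + u)) a≡ (exchange d s u)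
      where
      regroup : ∀ d s u → d + s + u + d ≡ d + s + (d + u)
      regroup = solve-∀
      a≡ : d + s + u ≡ a
      a≡ = ℕₚ.+-cancelʳ-≡ d _ _ (≡.trans (regroup d s u) (≡.sym balance))

  module _ (p : ℕ → Carrier) where

    toeplitz-at : ∀ i {j} n → i + n ≡ j → toeplitz R p i j ≡ p n
    toeplitz-at i n refl with i ℕₚ.≤? i + n
    ... | yes _   = ≡.cong p (ℕₚ.m+n∸m≡n i n)
    ... | no  i≰j = ⊥-elim (i≰j (ℕₚ.m≤m+n i n))

    toeplitz-below : ∀ {i j} → j ℕ.< i → toeplitz R p i j ≡ 0#
    toeplitz-below {i} {j} j<i with i ℕₚ.≤? j
    ... | yes i≤j = ⊥-elim (ℕₚ.<⇒≱ j<i i≤j)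
    ... | no  _   = refl

    toeplitz-nonneg : NonNegative R p → ∀ i j → 0# ≤ toeplitz R p i j
    toeplitz-nonneg nonneg i j with i ℕₚ.≤? j
    ... | yes _ = nonneg (j ℕ.∸ i)
    ... | no  _ = ≤-refl

    -- Row 0 of T_p is p itself, so TN₂ sequences are nonnegative.
    TN₂⇒NonNegative : TN₂ R p → NonNegative R p
    TN₂⇒NonNegative tn₂ n = ≡.subst (0# ≤_) (toeplitz-at 0 n refl) (proj₁ tn₂ 0 n)

    minor : ℕ → ℕ → ℕ → ℕ → Carrier
    minor i k j l = toeplitz R p i j * toeplitz R p k l - toeplitz R p i l * toeplitz R p k j

    minor-exchange : ∀ i s t u →
      minor i (i + s) (i + s + t) (i + s + t + u) ≡ p (t + s) * p (t + u) - p (t + s + u) * p t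
    minor-exchange i s t u =
      ≡.cong₂ _-_ (≡.cong₂ _*_ (toeplitz-at i (t + s) (e₁ i s t))
                                (toeplitz-at (i + s) (t + u) (e₂ i s t u)))
                (≡.cong₂ _*_ (toeplitz-at i (t + s + u) (e₃ i s t u)) (toeplitz-at (i + s) t refl))
      where
      e₁ : ∀ i s t → i + (t + s) ≡ i + s + t
      e₁ = solve-∀
      e₂ : ∀ i s t u → i + s + (t + u) ≡ i + s + t + u
      e₂ = solve-∀
      e₃ : ∀ i s t u → i + (t + s + u) ≡ i + s + t + u
      e₃ = solve-∀

    -- (i) ⇒ exchange: for s, u > 0 the inequality is the minor with rows 0 < s
    -- and columns s+t < s+t+u; for s = 0 or u = 0 it is an identity.
    TN₂⇒Exchange : TN₂ R p → Exchange p
    TN₂⇒Exchange tn₂ t zero u rewrite ℕₚ.+-identityʳ t = ≤-reflexive (*-comm _ _)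
    TN₂⇒Exchange tn₂ t s zero rewrite ℕₚ.+-identityʳ (t + s) | ℕₚ.+-identityʳ t = ≤-refl
    TN₂⇒Exchange tn₂ t (suc s) (suc u) =
      0≤-⇒≤ (≡.subst (0# ≤_) (minor-exchange 0 (suc s) t (suc u))
        (proj₂ tn₂ 0 (suc s) (suc s + t) (suc s + t + suc u) (s≤s z≤n) (ℕₚ.m<m+n _ (s≤s z≤n))))

    -- Exchange ⇒ (i): minors with a column left of both rows vanish, minors
    -- with a column between the rows are products of entries, and the
    -- remaining minors are exchange expressions.
    Exchange⇒TN₂ : NonNegative R p → Exchange p → TN₂ R p
    Exchange⇒TN₂ nonneg exchange = toeplitz-nonneg nonneg , minor-nonneg
      where
      minor-nonneg : ∀ i k j l → i ℕ.< k → j ℕ.< l → 0# ≤ minor i k j l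
      minor-nonneg i k j l i<k j<l with j ℕₚ.<? i | j ℕₚ.<? k
      ... | yes j<i | _
        rewrite toeplitz-below j<i | toeplitz-below (ℕₚ.<-trans j<i i<k) =
          ≤-respʳ-≈ (sym (trans (x-y*0≈x _ _) (zeroˡ _))) ≤-refl
      ... | no _ | yes j<k rewrite toeplitz-below j<k =
          ≤-respʳ-≈ (sym (x-y*0≈x _ _))
            (*-nonneg (toeplitz-nonneg nonneg i j) (toeplitz-nonneg nonneg k l))
      ... | no _ | no j≮k
        with ℕₚ.m≤n⇒∃[o]m+o≡n (ℕₚ.<⇒≤ i<k) | ℕₚ.m≤n⇒∃[o]m+o≡n (ℕₚ.≮⇒≥ j≮k)
           | ℕₚ.m≤n⇒∃[o]m+o≡n (ℕₚ.<⇒≤ j<l)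
      ... | s , refl | t , refl | u , refl =
          ≡.subst (0# ≤_) (≡.sym (minor-exchange i s t u)) (≤⇒0≤- (exchange t s u))

  module _ (p : ℕ → Carrier) (nonneg : NonNegative R p) (exchange : Exchange p) where

    ∏ : ∀ {m} → (Fin m → ℕ) → Carrier
    ∏ = prodP R p

    ∏-nonneg : ∀ {m} (f : Fin m → ℕ) → 0# ≤ ∏ f
    ∏-nonneg {zero}  f = 0≤1
    ∏-nonneg {suc m} f = *-nonneg (nonneg (head f)) (∏-nonneg (tail f))

    unit-move : ∀ {f z} → f ℕ.≤ z → p (suc z) * p f ≤ p z * p (suc f)
    unit-move {f} f≤z with ℕₚ.m≤n⇒∃[o]m+o≡n f≤z
    ... | u , refl = ≤-respʳ-≈ (*-comm _ _) (≡.subst₂ (λ x y → p x * p f ≤ p y * p (f + u))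
                                              (one-step f u) (ℕₚ.+-comm f 1) (exchange f 1 u))
      where
      one-step : ∀ f u → f + 1 + u ≡ suc (f + u)
      one-step = solve-∀

    -- If f covers g with credit d + 1 and every part of g is at most z, one
    -- unit can be moved from a factor p(z+1) into f.  It goes to the first
    -- position where the running credit would drop to zero; the part of f
    -- there is below that of g, hence at most z, so unit-move applies.
    transfer : ∀ {m} d z (f g : Fin m → ℕ) → Covers (suc d) f g → (∀ i → g i ℕ.≤ z) →
      ∃[ f′ ] Covers d f′ g × p (suc z) * ∏ f ≤ p z * ∏ f′
    transfer {zero}  d z f g () _
    transfer {suc m} d z f g (zero , split , covers) g≤z =
      (suc (head f) ∷ tail f) , (0 , ≡.trans (ℕₚ.+-suc d (head f)) split , covers) , moved
      where
      head-f≤z : head f ℕ.≤ z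
      head-f≤z = ℕₚ.≤-trans (ℕₚ.m≤n+m (head f) (suc d))
                  (ℕₚ.≤-trans (ℕₚ.≤-reflexive (≡.trans split (ℕₚ.+-identityʳ _))) (g≤z Fin.zero))
      moved : p (suc z) * (p (head f) * ∏ (tail f)) ≤ p z * (p (suc (head f)) * ∏ (tail f))
      moved = ≤-respˡ-≈ (*-assoc _ _ _) (≤-respʳ-≈ (*-assoc _ _ _)
                (≤-respˡ-≈ (*-comm _ _) (≤-respʳ-≈ (*-comm _ _)
                  (*-monoˡ-≤-nonneg (∏ (tail f)) (∏-nonneg (tail f)) (unit-move head-f≤z)))))
    transfer {suc m} d z f g (suc e , split , covers) g≤z
      with transfer e z (tail f) (tail g) covers (λ i → g≤z (Fin.suc i))
    ... | f′ , covers′ , moved =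
      (head f ∷ f′) , (e , ℕₚ.suc-injective (≡.trans split (ℕₚ.+-suc (head g) e)) , covers′) ,
      ≤-respˡ-≈ (x∙yz≈y∙xz _ _ _) (≤-respʳ-≈ (x∙yz≈y∙xz _ _ _)
        (*-monoˡ-≤-nonneg (p (head f)) (nonneg (head f)) moved))

    -- Iterating transfer d times spends the whole credit of a leading factor p(y+d).
    drain : ∀ {m} d y (f g : Fin m → ℕ) → Covers d f g → (∀ i → g i ℕ.≤ y) →
      ∃[ f′ ] Covers 0 f′ g × p (y + d) * ∏ f ≤ p y * ∏ f′
    drain zero y f g covers _ rewrite ℕₚ.+-identityʳ y = f , covers , ≤-refl
    drain (suc d) y f g covers g≤y rewrite ℕₚ.+-suc y d
      with transfer d (y + d) f g covers (λ i → ℕₚ.≤-trans (g≤y i) (ℕₚ.m≤m+n y d))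
    ... | f₁ , covers₁ , moved₁ with drain d y f₁ g covers₁ g≤y
    ...   | f′ , covers′ , moved′ = f′ , covers′ , ≤-trans moved₁ moved′

    -- Main inequality: if f covers the partition g then ∏ f ≤ ∏ g (f need not
    -- be sorted).  The first part of f exceeds that of g by the credit d,
    -- which drain redistributes over the tail.
    covered-∏-≤ : ∀ {m} (f g : Fin m → ℕ) → IsPartition g → Covers 0 f g → ∏ f ≤ ∏ g
    covered-∏-≤ {zero}  f g _ _ = ≤-refl
    covered-∏-≤ {suc m} f g partition (d , split , covers) rewrite split
      with drain d (head g) (tail f) (tail g) covers (λ i → partition Fin.zero (Fin.suc i) z≤n)
    ... | f′ , covers′ , drained =
      ≤-trans drained (*-monoˡ-≤-nonneg (p (head g)) (nonneg (head g))
        (covered-∏-≤ f′ (tail g) tail-partition covers′))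
      where
      tail-partition : IsPartition (tail g)
      tail-partition i j i≤j = partition (Fin.suc i) (Fin.suc j) (s≤s i≤j)

    Exchange⇒DominanceMonotone : DominanceMonotone p
    Exchange⇒DominanceMonotone m _ λ′ μ _ partition dominates =
      covered-∏-≤ λ′ μ partition (⊵⇒Covers λ′ μ dominates)

  -- (iii) ⇒ (ii): apply (iii) to the two-part partitions (a, d) ⊵ (b, c).
  DominanceMonotone⇒LogConcave : ∀ p → DominanceMonotone p → LogConcave p
  DominanceMonotone⇒LogConcave p monotone a b c d a≥b b≥c c≥d balance =
    ≤-respˡ-≈ (*-congˡ (*-identityʳ (p d))) (≤-respʳ-≈ (*-congˡ (*-identityʳ (p c)))
      (monotone 2 (s≤s z≤n) (pair a d) (pair b c)
        (pair-partition (ℕₚ.≤-trans c≥d (ℕₚ.≤-trans b≥c a≥b))) (pair-partition b≥c)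
        (equal-size , prefix-bound)))
    where
    pair : ℕ → ℕ → Fin 2 → ℕ
    pair x y = x ∷ y ∷ []
    pair-partition : ∀ {x y} → y ℕ.≤ x → IsPartition (pair x y)
    pair-partition y≤x Fin.zero       Fin.zero       _ = ℕₚ.≤-refl
    pair-partition y≤x Fin.zero       (Fin.suc Fin.zero) _ = y≤x
    pair-partition y≤x (Fin.suc Fin.zero) (Fin.suc Fin.zero) _ = ℕₚ.≤-refl
    equal-size : size (pair a d) ≡ size (pair b c)
    equal-size = ≡.subst₂ (λ x y → a + x ≡ b + y)
      (≡.sym (ℕₚ.+-identityʳ d)) (≡.sym (ℕₚ.+-identityʳ c)) balance
    prefix-bound : ∀ j → 1 ℕ.≤ j → j ℕ.≤ 2 → prefixSum (pair b c) j ℕ.≤ prefixSum (pair a d) j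
    prefix-bound 1 _ _ = ℕₚ.+-monoˡ-≤ 0 a≥b
    prefix-bound 2 _ _ = ℕₚ.≤-reflexive (≡.sym equal-size)
    prefix-bound (suc (suc (suc _))) _ (s≤s (s≤s ()))

lemma1 : ∀ {c ℓ₁ ℓ₂} (R : OrderedCommutativeRing c ℓ₁ ℓ₂) →
    let open OrderedCommutativeRing R in
    (p : ℕ → Carrier) →
      (TN₂ R p ⇔
        (NonNegative R p ×
          (∀ a b c d → a ℕ.≥ b → b ℕ.≥ c → c ℕ.≥ d → a ℕ.+ d ≡ b ℕ.+ c →
            p a * p d ≤ p b * p c)))
      ×
      (TN₂ R p ⇔
        (NonNegative R p ×
          (∀ (m : ℕ) → 0 ℕ.< m → (λ′ μ : Fin m → ℕ) →
            IsPartition λ′ → IsPartition μ → λ′ ⊵ μ →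
            prodP R p λ′ ≤ prodP R p μ)))
lemma1 R p =
  mk⇔ (λ tn₂ → nonneg tn₂ , Exchange⇒LogConcave p (TN₂⇒Exchange p tn₂))
      (λ (nn , logConcave) → Exchange⇒TN₂ p nn (LogConcave⇒Exchange p logConcave)) ,
  mk⇔ (λ tn₂ → nonneg tn₂ , Exchange⇒DominanceMonotone p (nonneg tn₂) (TN₂⇒Exchange p tn₂))
      (λ (nn , monotone) →
        Exchange⇒TN₂ p nn (LogConcave⇒Exchange p (DominanceMonotone⇒LogConcave p monotone)))
  where
  open Characterisation R
  nonneg : TN₂ R p → NonNegative R p
  nonneg = TN₂⇒NonNegative p
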